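{- (Denotations are candidates.) For every formula $A$: (1) $[\![A]\!]\subseteq\mathsf{SN}$; (2) $\mathsf{Ne}\subseteq[\![A]\!]$; (3) if $t\in[\![A]\!]$ and $s\to_{\mathsf{SN}} t$, then $s\in[\![A]\!]$.
   Context: Formulas are built from propositional atoms and $\bot$ using $\to,\land,\lor$. $\mathbf{KP}$-terms: $t,s,u ::= x \mid t\,s \mid \lambda x.t \mid \mathtt{efq}(t) \mid \langle t,s\rangle \mid \pi_i t \mid \mathtt{in}_i t \mid \mathtt{case}\ t\ [y.s_1]\ [y.s_2] \mid \mathtt{hop}(x.t,\ y.s_1,\ y.s_2)$ ($i\in\{1,2\}$), with $y$ bound in $s_1,s_2$ in $\mathtt{case}$ and $\mathtt{hop}$, $x$ bound in $t$ in $\mathtt{hop}$; $t\{x:=s\}$ is capture-avoiding substitution. Weak head $\mathbf{IPC}$ contexts: $W::=\Box\mid W\,t\mid\pi_i W\mid\mathtt{case}\ W\ [y.s_1]\ [y.s_2]$; weak head $\mathbf{KP}$ contexts: $K::=\Box\mid K\,s\mid\pi_i K\mid\mathtt{case}\ K\ [y.s_1]\ [y.s_2]\mid\mathtt{hop}(x.K,\ y.s_1,\ y.s_2)$; $K\langle t\rangle$ replaces the hole by $t$. Top-level reduction $\mapsto_{\mathbf{KP}}$: $(\lambda x.t)s\mapsto t\{x:=s\}$; $\pi_i\langle t_1,t_2\rangle\mapsto t_i$; $\mathtt{case}\,(\mathtt{in}_i t)\,[y.s_1][y.s_2]\mapsto s_i\{y:=t\}$; $\mathtt{hop}(x.\mathtt{in}_i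 t,y.s_1,y.s_2)\mapsto s_i\{y:=\lambda x.t\}$; $\mathtt{hop}(x.W\langle\mathtt{efq}(t)\rangle,y.s_1,y.s_2)\mapsto s_1\{y:=\lambda x.\mathtt{efq}(t)\}$; $\to_{\mathbf{KP}}$ is its closure under all term constructors. $\mathsf{SN}$ is the set of terms strongly normalizing for $\to_{\mathbf{KP}}$; a context is $\mathsf{SN}$ if all its terms are in $\mathsf{SN}$. $\to_{\mathsf{SN}}$: $K\langle r\rangle\to_{\mathsf{SN}}K\langle r'\rangle$ whenever $r\mapsto_{\mathbf{KP}} r'$ is one of the five top-level rules above, with $K$ (and $W$ in the last rule) $\mathsf{SN}$ contexts and all immediate subterms $t,s,s_1,s_2$ appearing in the rule in $\mathsf{SN}$. $\to_{\mathsf{SN}}^*$ is its reflexive-transitive closure; $t$ is a $\to_{\mathsf{SN}}$-normal form if $t\not\to_{\mathsf{SN}}$; $t\twoheadrightarrow_{\mathsf{SN}} s$ means $t\to_{\mathsf{SN}}^* s$ and $s$ is a $\to_{\mathsf{SN}}$-normal form. For a set $T$ of $\to_{\mathsf{SN}}$-normal forms, $\overline{T}:=\{s\mid s\twoheadrightarrow_{\mathsf{SN}} t\text{ for some }t\in T\}$. Neutral terms: $\mathsf{Ne}:=\{K\langle x\rangle\mid K\text{ an }\mathsf{SN}\text{ context}, x\text{ a variable}\}\cup\{W\langle\mathtt{efq}(t)\rangle\mid W\text{ and }t\text{ are }\mathsf{SN}\}$. Denotations: $[\![p]\!]:=\mathsf{SN}$ for $p$ atomic or $p=\bot$; $[\![A\to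 B]\!]:=\overline{\{\lambda x.t\mid \forall s\in[\![A]\!],\ t\{x:=s\}\in[\![B]\!]\}}\cup\overline{\mathsf{Ne}}$; $[\![A_1\land A_2]\!]:=\overline{\{\langle t_1,t_2\rangle\mid t_i\in[\![A_i]\!]\}}\cup\overline{\mathsf{Ne}}$; $[\![A_1\lor A_2]\!]:=\overline{\{\mathtt{in}_i t\mid t\in[\![A_i]\!]\}}\cup\overline{\mathsf{Ne}}$. -}

module Defs where

open import Data.Nat using (ℕ; zero; suc)
open import Data.Product using (Σ; ∃; _×_; _,_)
open import Data.Sum using (_⊎_)
open import Relation.Nullary using (¬_)
open import Relation.Binary.PropositionalEquality using (_≡_)
open import Relation.Binary.Construct.Closure.ReflexiveTransitive using (Star)

data Form : Set where
  atom : ℕ → Form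
  falsum : Form
  _⇒_ : Form → Form → Form
  _∧_ : Form → Form → Form
  _∨_ : Form → Form → Form

-- KP-terms (de Bruijn indices; index 0 = innermost binder)

data Idx : Set where
  i₁ i₂ : Idx

data Tm : Set where
  var  : ℕ → Tm
  app  : Tm → Tm → Tm
  lam  : Tm → Tm
  efq  : Tm → Tm
  pair : Tm → Tm → Tm
  proj : Idx → Tm → Tm
  inj  : Idx → Tm → Tm
  case : Tm → Tm → Tm → Tm       -- case t [y.s₁] [y.s₂] (s₁, s₂ under one binder)
  hop  : Tm → Tm → Tm → Tm       -- hop(x.t, y.s₁, y.s₂) (each argument under one binder)

ext : (ℕ → ℕ) → ℕ → ℕ
ext ρ zero = zero
ext ρ (suc n) = suc (ρ n)

rename : (ℕ → ℕ) → Tm → Tm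
rename ρ (var n) = var (ρ n)
rename ρ (app t s) = app (rename ρ t) (rename ρ s)
rename ρ (lam t) = lam (rename (ext ρ) t)
rename ρ (efq t) = efq (rename ρ t)
rename ρ (pair t s) = pair (rename ρ t) (rename ρ s)
rename ρ (proj i t) = proj i (rename ρ t)
rename ρ (inj i t) = inj i (rename ρ t)
rename ρ (case t s₁ s₂) = case (rename ρ t) (rename (ext ρ) s₁) (rename (ext ρ) s₂)
rename ρ (hop t s₁ s₂) = hop (rename (ext ρ) t) (rename (ext ρ) s₁) (rename (ext ρ) s₂)

exts : (ℕ → Tm) → ℕ → Tm
exts σ zero = var zero
exts σ (suc n) = rename suc (σ n)

sub : (ℕ → Tm) → Tm → Tm
sub σ (var n) = σ n
sub σ (app t s) = app (sub σ t) (sub σ s)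
sub σ (lam t) = lam (sub (exts σ) t)
sub σ (efq t) = efq (sub σ t)
sub σ (pair t s) = pair (sub σ t) (sub σ s)
sub σ (proj i t) = proj i (sub σ t)
sub σ (inj i t) = inj i (sub σ t)
sub σ (case t s₁ s₂) = case (sub σ t) (sub (exts σ) s₁) (sub (exts σ) s₂)
sub σ (hop t s₁ s₂) = hop (sub (exts σ) t) (sub (exts σ) s₁) (sub (exts σ) s₂)

single : Tm → ℕ → Tm
single s zero = s
single s (suc n) = var n

-- t [ s ] : substitute s for the variable bound by the outermost binder of t (index 0)
_[_] : Tm → Tm → Tm
t [ s ] = sub (single s) t

pick : Idx → Tm → Tm → Tm
pick i₁ a b = a
pick i₂ a b = b

data WCtx : Set where
  □     : WCtx
  appW  : WCtx → Tm → WCtx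
  projW : Idx → WCtx → WCtx
  caseW : WCtx → Tm → Tm → WCtx

plugW : WCtx → Tm → Tm
plugW □ t = t
plugW (appW W s) t = app (plugW W t) s
plugW (projW i W) t = proj i (plugW W t)
plugW (caseW W s₁ s₂) t = case (plugW W t) s₁ s₂

data KCtx : Set where
  □     : KCtx
  appK  : KCtx → Tm → KCtx
  projK : Idx → KCtx → KCtx
  caseK : KCtx → Tm → Tm → KCtx
  hopK  : KCtx → Tm → Tm → KCtx   -- hop(x.K, y.s₁, y.s₂)

-- plugging is literal replacement of the hole (no renaming)
plugK : KCtx → Tm → Tm
plugK □ t = t
plugK (appK K s) t = app (plugK K t) s
plugK (projK i K) t = proj i (plugK K t)
plugK (caseK K s₁ s₂) t = case (plugK K t) s₁ s₂
plugK (hopK K s₁ s₂) t = hop (plugK K t) s₁ s₂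

data _↦_ : Tm → Tm → Set where
  β     : ∀ {t s} → app (lam t) s ↦ (t [ s ])
  πβ    : ∀ {i t₁ t₂} → proj i (pair t₁ t₂) ↦ pick i t₁ t₂
  caseβ : ∀ {i t s₁ s₂} → case (inj i t) s₁ s₂ ↦ (pick i s₁ s₂ [ t ])
  hopβ  : ∀ {i t s₁ s₂} → hop (inj i t) s₁ s₂ ↦ (pick i s₁ s₂ [ lam t ])
  hopE  : ∀ {W t s₁ s₂} → hop (plugW W (efq t)) s₁ s₂ ↦ (s₁ [ lam (efq t) ])

data _⟶_ : Tm → Tm → Set where
  top    : ∀ {t t'} → t ↦ t' → t ⟶ t'
  appˡ   : ∀ {t t' s} → t ⟶ t' → app t s ⟶ app t' s
  appʳ   : ∀ {t s s'} → s ⟶ s' → app t s ⟶ app t s'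
  lamc   : ∀ {t t'} → t ⟶ t' → lam t ⟶ lam t'
  efqc   : ∀ {t t'} → t ⟶ t' → efq t ⟶ efq t'
  pairˡ  : ∀ {t t' s} → t ⟶ t' → pair t s ⟶ pair t' s
  pairʳ  : ∀ {t s s'} → s ⟶ s' → pair t s ⟶ pair t s'
  projc  : ∀ {i t t'} → t ⟶ t' → proj i t ⟶ proj i t'
  injc   : ∀ {i t t'} → t ⟶ t' → inj i t ⟶ inj i t'
  case₀  : ∀ {t t' s₁ s₂} → t ⟶ t' → case t s₁ s₂ ⟶ case t' s₁ s₂
  case₁  : ∀ {t s₁ s₁' s₂} → s₁ ⟶ s₁' → case t s₁ s₂ ⟶ case t s₁' s₂
  case₂  : ∀ {t s₁ s₂ s₂'} → s₂ ⟶ s₂' → case t s₁ s₂ ⟶ case t s₁ s₂'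
  hop₀   : ∀ {t t' s₁ s₂} → t ⟶ t' → hop t s₁ s₂ ⟶ hop t' s₁ s₂
  hop₁   : ∀ {t s₁ s₁' s₂} → s₁ ⟶ s₁' → hop t s₁ s₂ ⟶ hop t s₁' s₂
  hop₂   : ∀ {t s₁ s₂ s₂'} → s₂ ⟶ s₂' → hop t s₁ s₂ ⟶ hop t s₁ s₂'

data SN (t : Tm) : Set where
  sn : (∀ {t'} → t ⟶ t' → SN t') → SN t

SNW : WCtx → Set
SNW □ = Data.Unit.⊤ where import Data.Unit
SNW (appW W s) = SNW W × SN s
SNW (projW i W) = SNW W
SNW (caseW W s₁ s₂) = SNW W × SN s₁ × SN s₂

SNK : KCtx → Set
SNK □ = Data.Unit.⊤ where import Data.Unit
SNK (appK K s) = SNK K × SN s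
SNK (projK i K) = SNK K
SNK (caseK K s₁ s₂) = SNK K × SN s₁ × SN s₂
SNK (hopK K s₁ s₂) = SNK K × SN s₁ × SN s₂

data SNRedex : Tm → Tm → Set where
  β     : ∀ {t s} → SN t → SN s → SNRedex (app (lam t) s) (t [ s ])
  πβ    : ∀ {i t₁ t₂} → SN t₁ → SN t₂ → SNRedex (proj i (pair t₁ t₂)) (pick i t₁ t₂)
  caseβ : ∀ {i t s₁ s₂} → SN t → SN s₁ → SN s₂ →
          SNRedex (case (inj i t) s₁ s₂) (pick i s₁ s₂ [ t ])
  hopβ  : ∀ {i t s₁ s₂} → SN t → SN s₁ → SN s₂ →
          SNRedex (hop (inj i t) s₁ s₂) (pick i s₁ s₂ [ lam t ])
  hopE  : ∀ {W t s₁ s₂} → SNW W → SN t → SN s₁ → SN s₂ →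
          SNRedex (hop (plugW W (efq t)) s₁ s₂) (s₁ [ lam (efq t) ])

data _⟶SN_ : Tm → Tm → Set where
  step : ∀ {K r r'} → SNK K → SNRedex r r' → plugK K r ⟶SN plugK K r'

_⟶SN*_ : Tm → Tm → Set
_⟶SN*_ = Star _⟶SN_

NF-SN : Tm → Set
NF-SN t = ∀ {t'} → ¬ (t ⟶SN t')

_↠SN_ : Tm → Tm → Set
s ↠SN t = (s ⟶SN* t) × NF-SN t

closure : (Tm → Set) → Tm → Set
closure T s = ∃ λ t → (s ↠SN t) × T t

Ne : Tm → Set
Ne t = (Σ KCtx λ K → Σ ℕ λ x → SNK K × t ≡ plugK K (var x))
     ⊎ (Σ WCtx λ W → Σ Tm λ u → SNW W × SN u × t ≡ plugW W (efq u))

⟦_⟧ : Form → Tm → Set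
⟦ atom p ⟧ t = SN t
⟦ falsum ⟧ t = SN t
⟦ A ⇒ B ⟧ t =
  closure (λ u → Σ Tm λ b → u ≡ lam b × (∀ s → ⟦ A ⟧ s → ⟦ B ⟧ (b [ s ]))) t
  ⊎ closure Ne t
⟦ A₁ ∧ A₂ ⟧ t =
  closure (λ u → Σ Tm λ t₁ → Σ Tm λ t₂ → u ≡ pair t₁ t₂ × ⟦ A₁ ⟧ t₁ × ⟦ A₂ ⟧ t₂) t
  ⊎ closure Ne t
⟦ A₁ ∨ A₂ ⟧ t =
  closure (λ u → (Σ Tm λ a → u ≡ inj i₁ a × ⟦ A₁ ⟧ a)
               ⊎ (Σ Tm λ a → u ≡ inj i₂ a × ⟦ A₂ ⟧ a)) t
  ⊎ closure Ne t

-- The expansion lemmas recurse on several SN derivations at once, some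
-- of them passed on re-wrapped in  sn ; seeing that each call decreases
-- one of them needs termination depth 2.
{-# OPTIONS --termination-depth=2 #-}
module Submission where

-- Every compound denotation is a union of closures  T̄ = {s | s ↠SN t ∈ T}.
-- Hence (3) holds by prepending the step, (2) holds because neutral terms
-- are SN and already →SN-normal, and (1) reduces to two facts: SN is
-- closed under →SN expansion, and SN is closed under the introduction
-- forms (for λb one first instantiates b with the neutral variable 0).

open import Defs
open import Data.Nat using (ℕ; zero; suc)
open import Data.Product using (Σ; _×_; _,_; proj₁; proj₂)
open import Data.Sum using (_⊎_; inj₁; inj₂; [_,_])
import Data.Sum as Sum
open import Data.Empty using (⊥; ⊥-elim)
open import Relation.Nullary using (¬_)
open import Data.Unit using (tt)
open import Relation.Binary.PropositionalEquality
  using (_≡_; _≗_; refl; sym; trans; cong; cong₂; subst; subst₂; module ≡-Reasoning)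
open import Relation.Binary.Construct.Closure.ReflexiveTransitive using (Star; ε; _◅_; _◅◅_; gmap)
open import Function using (_∘_)

cong₃ : ∀ (f : Tm → Tm → Tm → Tm) {a b c a' b' c'} →
        a ≡ a' → b ≡ b' → c ≡ c' → f a b c ≡ f a' b' c'
cong₃ f refl refl refl = refl

ext-cong : ∀ {ρ ρ'} → ρ ≗ ρ' → ext ρ ≗ ext ρ'
ext-cong e zero    = refl
ext-cong e (suc x) = cong suc (e x)

ren-cong : ∀ {ρ ρ'} → ρ ≗ ρ' → ∀ t → rename ρ t ≡ rename ρ' t
ren-cong e (var x)        = cong var (e x)
ren-cong e (app t s)      = cong₂ app (ren-cong e t) (ren-cong e s)
ren-cong e (lam t)        = cong lam (ren-cong (ext-cong e) t)
ren-cong e (efq t)        = cong efq (ren-cong e t)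
ren-cong e (pair t s)     = cong₂ pair (ren-cong e t) (ren-cong e s)
ren-cong e (proj i t)     = cong (proj i) (ren-cong e t)
ren-cong e (inj i t)      = cong (inj i) (ren-cong e t)
ren-cong e (case t s₁ s₂) =
  cong₃ case (ren-cong e t) (ren-cong (ext-cong e) s₁) (ren-cong (ext-cong e) s₂)
ren-cong e (hop t s₁ s₂)  =
  cong₃ hop (ren-cong (ext-cong e) t) (ren-cong (ext-cong e) s₁) (ren-cong (ext-cong e) s₂)

exts-cong : ∀ {σ σ'} → σ ≗ σ' → exts σ ≗ exts σ'
exts-cong e zero    = refl
exts-cong e (suc x) = cong (rename suc) (e x)

sub-cong : ∀ {σ σ'} → σ ≗ σ' → ∀ t → sub σ t ≡ sub σ' t
sub-cong e (var x)        = e x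
sub-cong e (app t s)      = cong₂ app (sub-cong e t) (sub-cong e s)
sub-cong e (lam t)        = cong lam (sub-cong (exts-cong e) t)
sub-cong e (efq t)        = cong efq (sub-cong e t)
sub-cong e (pair t s)     = cong₂ pair (sub-cong e t) (sub-cong e s)
sub-cong e (proj i t)     = cong (proj i) (sub-cong e t)
sub-cong e (inj i t)      = cong (inj i) (sub-cong e t)
sub-cong e (case t s₁ s₂) =
  cong₃ case (sub-cong e t) (sub-cong (exts-cong e) s₁) (sub-cong (exts-cong e) s₂)
sub-cong e (hop t s₁ s₂)  =
  cong₃ hop (sub-cong (exts-cong e) t) (sub-cong (exts-cong e) s₁) (sub-cong (exts-cong e) s₂)

ext-∘ : ∀ ρ ρ' → ext ρ ∘ ext ρ' ≗ ext (ρ ∘ ρ')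
ext-∘ ρ ρ' zero    = refl
ext-∘ ρ ρ' (suc x) = refl

ren-ren  : ∀ ρ ρ' t → rename ρ (rename ρ' t) ≡ rename (ρ ∘ ρ') t
ren-ren↑ : ∀ ρ ρ' t → rename (ext ρ) (rename (ext ρ') t) ≡ rename (ext (ρ ∘ ρ')) t

ren-ren↑ ρ ρ' t = trans (ren-ren (ext ρ) (ext ρ') t) (ren-cong (ext-∘ ρ ρ') t)

ren-ren ρ ρ' (var x)        = refl
ren-ren ρ ρ' (app t s)      = cong₂ app (ren-ren ρ ρ' t) (ren-ren ρ ρ' s)
ren-ren ρ ρ' (lam t)        = cong lam (ren-ren↑ ρ ρ' t)
ren-ren ρ ρ' (efq t)        = cong efq (ren-ren ρ ρ' t)
ren-ren ρ ρ' (pair t s)     = cong₂ pair (ren-ren ρ ρ' t) (ren-ren ρ ρ' s)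
ren-ren ρ ρ' (proj i t)     = cong (proj i) (ren-ren ρ ρ' t)
ren-ren ρ ρ' (inj i t)      = cong (inj i) (ren-ren ρ ρ' t)
ren-ren ρ ρ' (case t s₁ s₂) =
  cong₃ case (ren-ren ρ ρ' t) (ren-ren↑ ρ ρ' s₁) (ren-ren↑ ρ ρ' s₂)
ren-ren ρ ρ' (hop t s₁ s₂)  =
  cong₃ hop (ren-ren↑ ρ ρ' t) (ren-ren↑ ρ ρ' s₁) (ren-ren↑ ρ ρ' s₂)

exts-ren : ∀ σ ρ → exts σ ∘ ext ρ ≗ exts (σ ∘ ρ)
exts-ren σ ρ zero    = refl
exts-ren σ ρ (suc x) = refl

sub-ren  : ∀ σ ρ t → sub σ (rename ρ t) ≡ sub (σ ∘ ρ) t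
sub-ren↑ : ∀ σ ρ t → sub (exts σ) (rename (ext ρ) t) ≡ sub (exts (σ ∘ ρ)) t

sub-ren↑ σ ρ t = trans (sub-ren (exts σ) (ext ρ) t) (sub-cong (exts-ren σ ρ) t)

sub-ren σ ρ (var x)        = refl
sub-ren σ ρ (app t s)      = cong₂ app (sub-ren σ ρ t) (sub-ren σ ρ s)
sub-ren σ ρ (lam t)        = cong lam (sub-ren↑ σ ρ t)
sub-ren σ ρ (efq t)        = cong efq (sub-ren σ ρ t)
sub-ren σ ρ (pair t s)     = cong₂ pair (sub-ren σ ρ t) (sub-ren σ ρ s)
sub-ren σ ρ (proj i t)     = cong (proj i) (sub-ren σ ρ t)
sub-ren σ ρ (inj i t)      = cong (inj i) (sub-ren σ ρ t)
sub-ren σ ρ (case t s₁ s₂) =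
  cong₃ case (sub-ren σ ρ t) (sub-ren↑ σ ρ s₁) (sub-ren↑ σ ρ s₂)
sub-ren σ ρ (hop t s₁ s₂)  =
  cong₃ hop (sub-ren↑ σ ρ t) (sub-ren↑ σ ρ s₁) (sub-ren↑ σ ρ s₂)

ren-exts : ∀ ρ σ → rename (ext ρ) ∘ exts σ ≗ exts (rename ρ ∘ σ)
ren-exts ρ σ zero    = refl
ren-exts ρ σ (suc x) = trans (ren-ren (ext ρ) suc (σ x)) (sym (ren-ren suc ρ (σ x)))

ren-sub  : ∀ ρ σ t → rename ρ (sub σ t) ≡ sub (rename ρ ∘ σ) t
ren-sub↑ : ∀ ρ σ t → rename (ext ρ) (sub (exts σ) t) ≡ sub (exts (rename ρ ∘ σ)) t

ren-sub↑ ρ σ t = trans (ren-sub (ext ρ) (exts σ) t) (sub-cong (ren-exts ρ σ) t)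

ren-sub ρ σ (var x)        = refl
ren-sub ρ σ (app t s)      = cong₂ app (ren-sub ρ σ t) (ren-sub ρ σ s)
ren-sub ρ σ (lam t)        = cong lam (ren-sub↑ ρ σ t)
ren-sub ρ σ (efq t)        = cong efq (ren-sub ρ σ t)
ren-sub ρ σ (pair t s)     = cong₂ pair (ren-sub ρ σ t) (ren-sub ρ σ s)
ren-sub ρ σ (proj i t)     = cong (proj i) (ren-sub ρ σ t)
ren-sub ρ σ (inj i t)      = cong (inj i) (ren-sub ρ σ t)
ren-sub ρ σ (case t s₁ s₂) =
  cong₃ case (ren-sub ρ σ t) (ren-sub↑ ρ σ s₁) (ren-sub↑ ρ σ s₂)
ren-sub ρ σ (hop t s₁ s₂)  =
  cong₃ hop (ren-sub↑ ρ σ t) (ren-sub↑ ρ σ s₁) (ren-sub↑ ρ σ s₂)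

exts-sub : ∀ σ τ → sub (exts σ) ∘ exts τ ≗ exts (sub σ ∘ τ)
exts-sub σ τ zero    = refl
exts-sub σ τ (suc x) = trans (sub-ren (exts σ) suc (τ x)) (sym (ren-sub suc σ (τ x)))

sub-sub  : ∀ σ τ t → sub σ (sub τ t) ≡ sub (sub σ ∘ τ) t
sub-sub↑ : ∀ σ τ t → sub (exts σ) (sub (exts τ) t) ≡ sub (exts (sub σ ∘ τ)) t

sub-sub↑ σ τ t = trans (sub-sub (exts σ) (exts τ) t) (sub-cong (exts-sub σ τ) t)

sub-sub σ τ (var x)        = refl
sub-sub σ τ (app t s)      = cong₂ app (sub-sub σ τ t) (sub-sub σ τ s)
sub-sub σ τ (lam t)        = cong lam (sub-sub↑ σ τ t)
sub-sub σ τ (efq t)        = cong efq (sub-sub σ τ t)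
sub-sub σ τ (pair t s)     = cong₂ pair (sub-sub σ τ t) (sub-sub σ τ s)
sub-sub σ τ (proj i t)     = cong (proj i) (sub-sub σ τ t)
sub-sub σ τ (inj i t)      = cong (inj i) (sub-sub σ τ t)
sub-sub σ τ (case t s₁ s₂) =
  cong₃ case (sub-sub σ τ t) (sub-sub↑ σ τ s₁) (sub-sub↑ σ τ s₂)
sub-sub σ τ (hop t s₁ s₂)  =
  cong₃ hop (sub-sub↑ σ τ t) (sub-sub↑ σ τ s₁) (sub-sub↑ σ τ s₂)

exts-var : exts var ≗ var
exts-var zero    = refl
exts-var (suc x) = refl

sub-var  : ∀ t → sub var t ≡ t
sub-var↑ : ∀ t → sub (exts var) t ≡ t

sub-var↑ t = trans (sub-cong exts-var t) (sub-var t)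

sub-var (var x)        = refl
sub-var (app t s)      = cong₂ app (sub-var t) (sub-var s)
sub-var (lam t)        = cong lam (sub-var↑ t)
sub-var (efq t)        = cong efq (sub-var t)
sub-var (pair t s)     = cong₂ pair (sub-var t) (sub-var s)
sub-var (proj i t)     = cong (proj i) (sub-var t)
sub-var (inj i t)      = cong (inj i) (sub-var t)
sub-var (case t s₁ s₂) = cong₃ case (sub-var t) (sub-var↑ s₁) (sub-var↑ s₂)
sub-var (hop t s₁ s₂)  = cong₃ hop (sub-var↑ t) (sub-var↑ s₁) (sub-var↑ s₂)

var-ext : ∀ ρ → var ∘ ext ρ ≗ exts (var ∘ ρ)
var-ext ρ zero    = refl
var-ext ρ (suc x) = refl

ren-as-sub  : ∀ ρ t → rename ρ t ≡ sub (var ∘ ρ) t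
ren-as-sub↑ : ∀ ρ t → rename (ext ρ) t ≡ sub (exts (var ∘ ρ)) t

ren-as-sub↑ ρ t = trans (ren-as-sub (ext ρ) t) (sub-cong (var-ext ρ) t)

ren-as-sub ρ (var x)        = refl
ren-as-sub ρ (app t s)      = cong₂ app (ren-as-sub ρ t) (ren-as-sub ρ s)
ren-as-sub ρ (lam t)        = cong lam (ren-as-sub↑ ρ t)
ren-as-sub ρ (efq t)        = cong efq (ren-as-sub ρ t)
ren-as-sub ρ (pair t s)     = cong₂ pair (ren-as-sub ρ t) (ren-as-sub ρ s)
ren-as-sub ρ (proj i t)     = cong (proj i) (ren-as-sub ρ t)
ren-as-sub ρ (inj i t)      = cong (inj i) (ren-as-sub ρ t)
ren-as-sub ρ (case t s₁ s₂) =
  cong₃ case (ren-as-sub ρ t) (ren-as-sub↑ ρ s₁) (ren-as-sub↑ ρ s₂)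
ren-as-sub ρ (hop t s₁ s₂)  =
  cong₃ hop (ren-as-sub↑ ρ t) (ren-as-sub↑ ρ s₁) (ren-as-sub↑ ρ s₂)

sub-single : ∀ σ t s → sub σ (t [ s ]) ≡ sub (exts σ) t [ sub σ s ]
sub-single σ t s = begin
  sub σ (sub (single s) t)                ≡⟨ sub-sub σ (single s) t ⟩
  sub (sub σ ∘ single s) t                ≡⟨ sub-cong agree t ⟩
  sub (sub (single (sub σ s)) ∘ exts σ) t ≡⟨ sym (sub-sub (single (sub σ s)) (exts σ) t) ⟩
  sub (single (sub σ s)) (sub (exts σ) t) ∎
  where
  open ≡-Reasoning
  agree : sub σ ∘ single s ≗ sub (single (sub σ s)) ∘ exts σ
  agree zero    = refl
  agree (suc x) = sym (trans (sub-ren (single (sub σ s)) suc (σ x)) (sub-var (σ x)))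

_⟶*_ : Tm → Tm → Set
_⟶*_ = Star _⟶_

subW : (ℕ → Tm) → WCtx → WCtx
subW τ □               = □
subW τ (appW W s)      = appW (subW τ W) (sub τ s)
subW τ (projW i W)     = projW i (subW τ W)
subW τ (caseW W s₁ s₂) = caseW (subW τ W) (sub (exts τ) s₁) (sub (exts τ) s₂)

sub-plugW : ∀ τ W e → sub τ (plugW W e) ≡ plugW (subW τ W) (sub τ e)
sub-plugW τ □               e = refl
sub-plugW τ (appW W s)      e = cong (λ z → app z (sub τ s)) (sub-plugW τ W e)
sub-plugW τ (projW i W)     e = cong (proj i) (sub-plugW τ W e)
sub-plugW τ (caseW W s₁ s₂) e =
  cong (λ z → case z (sub (exts τ) s₁) (sub (exts τ) s₂)) (sub-plugW τ W e)

↦-≡ : ∀ {a b c} → a ↦ b → b ≡ c → a ↦ c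
↦-≡ r refl = r

sub-↦ : ∀ σ {t t'} → t ↦ t' → sub σ t ↦ sub σ t'
sub-↦ σ (β {t} {s})                         = ↦-≡ β (sym (sub-single σ t s))
sub-↦ σ (πβ {i₁})                           = πβ
sub-↦ σ (πβ {i₂})                           = πβ
sub-↦ σ (caseβ {i₁} {t} {s₁})               = ↦-≡ caseβ (sym (sub-single σ s₁ t))
sub-↦ σ (caseβ {i₂} {t} {s₁} {s₂})          = ↦-≡ caseβ (sym (sub-single σ s₂ t))
sub-↦ σ (hopβ {i₁} {t} {s₁})                = ↦-≡ hopβ (sym (sub-single σ s₁ (lam t)))
sub-↦ σ (hopβ {i₂} {t} {s₁} {s₂})           = ↦-≡ hopβ (sym (sub-single σ s₂ (lam t)))
sub-↦ σ (hopE {W} {t} {s₁} {s₂}) =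
  subst₂ _↦_ (cong (λ z → hop z (sub (exts σ) s₁) (sub (exts σ) s₂))
                   (sym (sub-plugW (exts σ) W (efq t))))
             (sym (sub-single σ s₁ (lam (efq t))))
             (hopE {W = subW (exts σ) W})

sub-⟶ : ∀ σ {t t'} → t ⟶ t' → sub σ t ⟶ sub σ t'
sub-⟶ σ (top r)   = top (sub-↦ σ r)
sub-⟶ σ (appˡ p)  = appˡ (sub-⟶ σ p)
sub-⟶ σ (appʳ p)  = appʳ (sub-⟶ σ p)
sub-⟶ σ (lamc p)  = lamc (sub-⟶ (exts σ) p)
sub-⟶ σ (efqc p)  = efqc (sub-⟶ σ p)
sub-⟶ σ (pairˡ p) = pairˡ (sub-⟶ σ p)
sub-⟶ σ (pairʳ p) = pairʳ (sub-⟶ σ p)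
sub-⟶ σ (projc p) = projc (sub-⟶ σ p)
sub-⟶ σ (injc p)  = injc (sub-⟶ σ p)
sub-⟶ σ (case₀ p) = case₀ (sub-⟶ σ p)
sub-⟶ σ (case₁ p) = case₁ (sub-⟶ (exts σ) p)
sub-⟶ σ (case₂ p) = case₂ (sub-⟶ (exts σ) p)
sub-⟶ σ (hop₀ p)  = hop₀ (sub-⟶ (exts σ) p)
sub-⟶ σ (hop₁ p)  = hop₁ (sub-⟶ (exts σ) p)
sub-⟶ σ (hop₂ p)  = hop₂ (sub-⟶ (exts σ) p)

rename-⟶ : ∀ ρ {t t'} → t ⟶ t' → rename ρ t ⟶ rename ρ t'
rename-⟶ ρ {t} {t'} p =
  subst₂ _⟶_ (sym (ren-as-sub ρ t)) (sym (ren-as-sub ρ t')) (sub-⟶ (var ∘ ρ) p)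

_⟶*ₛ_ : (ℕ → Tm) → (ℕ → Tm) → Set
σ ⟶*ₛ σ' = ∀ x → σ x ⟶* σ' x

exts-⟶* : ∀ {σ σ'} → σ ⟶*ₛ σ' → exts σ ⟶*ₛ exts σ'
exts-⟶* h zero    = ε
exts-⟶* h (suc x) = gmap (rename suc) (rename-⟶ suc) (h x)

sub-⟶* : ∀ {σ σ'} → σ ⟶*ₛ σ' → ∀ t → sub σ t ⟶* sub σ' t
sub-⟶* h (var x)        = h x
sub-⟶* h (app t s)      = gmap _ appˡ (sub-⟶* h t) ◅◅ gmap _ appʳ (sub-⟶* h s)
sub-⟶* h (lam t)        = gmap _ lamc (sub-⟶* (exts-⟶* h) t)
sub-⟶* h (efq t)        = gmap _ efqc (sub-⟶* h t)
sub-⟶* h (pair t s)     = gmap _ pairˡ (sub-⟶* h t) ◅◅ gmap _ pairʳ (sub-⟶* h s)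
sub-⟶* h (proj i t)     = gmap _ projc (sub-⟶* h t)
sub-⟶* h (inj i t)      = gmap _ injc (sub-⟶* h t)
sub-⟶* h (case t s₁ s₂) =
  gmap _ case₀ (sub-⟶* h t) ◅◅ gmap _ case₁ (sub-⟶* (exts-⟶* h) s₁)
                            ◅◅ gmap _ case₂ (sub-⟶* (exts-⟶* h) s₂)
sub-⟶* h (hop t s₁ s₂)  =
  gmap _ hop₀ (sub-⟶* (exts-⟶* h) t) ◅◅ gmap _ hop₁ (sub-⟶* (exts-⟶* h) s₁)
                                     ◅◅ gmap _ hop₂ (sub-⟶* (exts-⟶* h) s₂)

[]-argument : ∀ t {s s'} → s ⟶ s' → (t [ s ]) ⟶* (t [ s' ])
[]-argument t {s} {s'} p = sub-⟶* single-⟶* t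
  where
  single-⟶* : single s ⟶*ₛ single s'
  single-⟶* zero    = p ◅ ε
  single-⟶* (suc x) = ε

[]-body : ∀ s {a a'} → a ⟶* a' → (a [ s ]) ⟶* (a' [ s ])
[]-body s = gmap (_[ s ]) (sub-⟶ (single s))

pick-left : ∀ i {a a' b} → a ⟶ a' → pick i a b ⟶* pick i a' b
pick-left i₁ p = p ◅ ε
pick-left i₂ p = ε

pick-right : ∀ i {a b b'} → b ⟶ b' → pick i a b ⟶* pick i a b'
pick-right i₁ p = ε
pick-right i₂ p = p ◅ ε

plug-⟶ : ∀ K {t t'} → t ⟶ t' → plugK K t ⟶ plugK K t'
plug-⟶ □               p = p
plug-⟶ (appK K s)      p = appˡ (plug-⟶ K p)
plug-⟶ (projK i K)     p = projc (plug-⟶ K p)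
plug-⟶ (caseK K s₁ s₂) p = case₀ (plug-⟶ K p)
plug-⟶ (hopK K s₁ s₂)  p = hop₀ (plug-⟶ K p)

plug-⟶* : ∀ K {t t'} → t ⟶* t' → plugK K t ⟶* plugK K t'
plug-⟶* K = gmap (plugK K) (plug-⟶ K)

SN-⟶ : ∀ {t t'} → SN t → t ⟶ t' → SN t'
SN-⟶ (sn h) p = h p

SN-⟶* : ∀ {t t'} → SN t → t ⟶* t' → SN t'
SN-⟶* h ε        = h
SN-⟶* h (p ◅ ps) = SN-⟶* (SN-⟶ h p) ps

SN-var : ∀ {x} → SN (var x)
SN-var = sn λ { (top ()) }

SN-efq : ∀ {t} → SN t → SN (efq t)
SN-efq (sn h) = sn λ { (top ()) ; (efqc p) → SN-efq (h p) }

SN-lam : ∀ {t} → SN t → SN (lam t)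
SN-lam (sn h) = sn λ { (top ()) ; (lamc p) → SN-lam (h p) }

SN-inj : ∀ {i t} → SN t → SN (inj i t)
SN-inj (sn h) = sn λ { (top ()) ; (injc p) → SN-inj (h p) }

SN-pair : ∀ {t s} → SN t → SN s → SN (pair t s)
SN-pair (sn h) (sn g) = sn λ { (top ())
                             ; (pairˡ p) → SN-pair (h p) (sn g)
                             ; (pairʳ p) → SN-pair (sn h) (g p) }

-- Since substitution preserves reduction, an infinite reduction of t
-- would give one of  sub σ t.
SN-unsub : ∀ σ t → SN (sub σ t) → SN t
SN-unsub σ t (sn h) = sn λ p → SN-unsub σ _ (h (sub-⟶ σ p))

-- Introductions (λ, pairs, injections) and efq-spines  W⟨efq u⟩  are
-- the only terms that can be the principal argument of a top-level
-- redex; var-spines  K⟨x⟩  are the neutral terms of the first kind.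

data Intro : Tm → Set where
  lam  : ∀ {b} → Intro (lam b)
  pair : ∀ {a b} → Intro (pair a b)
  inj  : ∀ {i a} → Intro (inj i a)

data EfqSpine : Tm → Set where
  efq  : ∀ {u} → EfqSpine (efq u)
  app  : ∀ {a s} → EfqSpine a → EfqSpine (app a s)
  proj : ∀ {i a} → EfqSpine a → EfqSpine (proj i a)
  case : ∀ {a s₁ s₂} → EfqSpine a → EfqSpine (case a s₁ s₂)

data VarSpine : Tm → Set where
  var  : ∀ {x} → VarSpine (var x)
  app  : ∀ {a s} → VarSpine a → VarSpine (app a s)
  proj : ∀ {i a} → VarSpine a → VarSpine (proj i a)
  case : ∀ {a s₁ s₂} → VarSpine a → VarSpine (case a s₁ s₂)
  hop  : ∀ {a s₁ s₂} → VarSpine a → VarSpine (hop a s₁ s₂)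

efq-spine : ∀ W {u} → EfqSpine (plugW W (efq u))
efq-spine □               = efq
efq-spine (appW W s)      = app (efq-spine W)
efq-spine (projW i W)     = proj (efq-spine W)
efq-spine (caseW W s₁ s₂) = case (efq-spine W)

var-spine : ∀ K {x} → VarSpine (plugK K (var x))
var-spine □               = var
var-spine (appK K s)      = app (var-spine K)
var-spine (projK i K)     = proj (var-spine K)
var-spine (caseK K s₁ s₂) = case (var-spine K)
var-spine (hopK K s₁ s₂)  = hop (var-spine K)

efq-not-intro : ∀ {a} → EfqSpine a → Intro a → ⊥
efq-not-intro efq ()
efq-not-intro (app _) ()
efq-not-intro (proj _) ()
efq-not-intro (case _) ()

var-not-intro : ∀ {a} → VarSpine a → Intro a → ⊥
var-not-intro var ()
var-not-intro (app _) ()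
var-not-intro (proj _) ()
var-not-intro (case _) ()
var-not-intro (hop _) ()

var-not-efq : ∀ {a} → VarSpine a → EfqSpine a → ⊥
var-not-efq (app v)  (app e)  = var-not-efq v e
var-not-efq (proj v) (proj e) = var-not-efq v e
var-not-efq (case v) (case e) = var-not-efq v e

-- The body u of an efq-spine W⟨efq u⟩ is determined by the term
-- (efq-body is arbitrary on other terms).
efq-body : Tm → Tm
efq-body (efq u)      = u
efq-body (app a s)    = efq-body a
efq-body (proj i a)   = efq-body a
efq-body (case a _ _) = efq-body a
efq-body a            = a

efq-body-plug : ∀ W {u} → efq-body (plugW W (efq u)) ≡ u
efq-body-plug □               = refl
efq-body-plug (appW W s)      = efq-body-plug W
efq-body-plug (projW i W)     = efq-body-plug W
efq-body-plug (caseW W s₁ s₂) = efq-body-plug W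

plugW-efq-injective : ∀ W W' {u u'} → plugW W (efq u) ≡ plugW W' (efq u') → u ≡ u'
plugW-efq-injective W W' {u} {u'} e = begin
  u                            ≡⟨ sym (efq-body-plug W) ⟩
  efq-body (plugW W (efq u))   ≡⟨ cong efq-body e ⟩
  efq-body (plugW W' (efq u')) ≡⟨ efq-body-plug W' ⟩
  u'                           ∎
  where open ≡-Reasoning

app-top : ∀ {a s u} → app a s ↦ u → Intro a
app-top β = lam

proj-top : ∀ {i a u} → proj i a ↦ u → Intro a
proj-top πβ = pair

case-top : ∀ {a s₁ s₂ u} → case a s₁ s₂ ↦ u → Intro a
case-top caseβ = inj

hop-top : ∀ {a s₁ s₂ u} → hop a s₁ s₂ ↦ u →
  (Σ Idx λ i → Σ Tm λ b → a ≡ inj i b × u ≡ (pick i s₁ s₂ [ lam b ]))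
  ⊎ (Σ WCtx λ W → Σ Tm λ b → a ≡ plugW W (efq b) × u ≡ (s₁ [ lam (efq b) ]))
hop-top hopβ = inj₁ (_ , _ , refl , refl)
hop-top hopE = inj₂ (_ , _ , refl , refl)

-- The two hop rules never overlap, so the contractum is determined.

hop-inj-contractum : ∀ {i t s₁ s₂ u} → hop (inj i t) s₁ s₂ ↦ u → u ≡ (pick i s₁ s₂ [ lam t ])
hop-inj-contractum r with hop-top r
... | inj₁ (_ , _ , refl , e) = e
... | inj₂ (W , _ , e , _)    = ⊥-elim (efq-not-intro (subst EfqSpine (sym e) (efq-spine W)) inj)

hop-efq-contractum : ∀ W {t s₁ s₂ u} → hop (plugW W (efq t)) s₁ s₂ ↦ u → u ≡ (s₁ [ lam (efq t) ])
hop-efq-contractum W {s₁ = s₁} r with hop-top r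
... | inj₁ (_ , _ , e , _)    = ⊥-elim (efq-not-intro (subst EfqSpine e (efq-spine W)) inj)
... | inj₂ (W' , _ , e , refl) =
  cong (λ z → s₁ [ lam (efq z) ]) (sym (plugW-efq-injective W W' e))

-- Neither introduction nor efq-spine: the term can head no redex.
Rigid : Tm → Set
Rigid a = ¬ Intro a × ¬ EfqSpine a

hop-top-rigid : ∀ {a s₁ s₂ u} → Rigid a → hop a s₁ s₂ ↦ u → ⊥
hop-top-rigid (¬intro , ¬efq) r with hop-top r
... | inj₁ (_ , _ , refl , _) = ¬intro inj
... | inj₂ (W , _ , refl , _) = ¬efq (efq-spine W)

rigid-plug : ∀ K {r} → Rigid r → Rigid (plugK K r)
rigid-plug □               R = R
rigid-plug (appK K s)      R = (λ ()) , λ { (app e) → proj₂ (rigid-plug K R) e }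
rigid-plug (projK i K)     R = (λ ()) , λ { (proj e) → proj₂ (rigid-plug K R) e }
rigid-plug (caseK K s₁ s₂) R = (λ ()) , λ { (case e) → proj₂ (rigid-plug K R) e }
rigid-plug (hopK K s₁ s₂)  R = (λ ()) , (λ ())

var-rigid : ∀ {a} → VarSpine a → Rigid a
var-rigid v = var-not-intro v , var-not-efq v

-- In K⟨r⟩ with r rigid, no frame of K forms a redex with the term below
-- it, so a step either reduces r or reduces a term of K.
data ContextStep (K : KCtx) (r : Tm) : Tm → Set where
  inside  : ∀ {r₀} → r ⟶ r₀ → ContextStep K r (plugK K r₀)
  outside : ∀ {K'} → (∀ v → plugK K v ⟶ plugK K' v) → ContextStep K r (plugK K' r)

context-step : ∀ K {r u} → Rigid r → plugK K r ⟶ u → ContextStep K r u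
context-step □ R p = inside p
context-step (appK K s) R (top p) = ⊥-elim (proj₁ (rigid-plug K R) (app-top p))
context-step (appK K s) R (appˡ p) with context-step K R p
... | inside q  = inside q
... | outside f = outside (λ v → appˡ (f v))
context-step (appK K s) R (appʳ p) = outside (λ v → appʳ p)
context-step (projK i K) R (top p) = ⊥-elim (proj₁ (rigid-plug K R) (proj-top p))
context-step (projK i K) R (projc p) with context-step K R p
... | inside q  = inside q
... | outside f = outside (λ v → projc (f v))
context-step (caseK K s₁ s₂) R (top p) = ⊥-elim (proj₁ (rigid-plug K R) (case-top p))
context-step (caseK K s₁ s₂) R (case₀ p) with context-step K R p
... | inside q  = inside q
... | outside f = outside (λ v → case₀ (f v))
context-step (caseK K s₁ s₂) R (case₁ p) = outside (λ v → case₁ p)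
context-step (caseK K s₁ s₂) R (case₂ p) = outside (λ v → case₂ p)
context-step (hopK K s₁ s₂) R (top p) = ⊥-elim (hop-top-rigid (rigid-plug K R) p)
context-step (hopK K s₁ s₂) R (hop₀ p) with context-step K R p
... | inside q  = inside q
... | outside f = outside (λ v → hop₀ (f v))
context-step (hopK K s₁ s₂) R (hop₁ p) = outside (λ v → hop₁ p)
context-step (hopK K s₁ s₂) R (hop₂ p) = outside (λ v → hop₂ p)

data EfqSpineStep (t : Tm) : Tm → Set where
  body    : ∀ {W t'} → t ⟶ t' → EfqSpineStep t (plugW W (efq t'))
  context : ∀ {W} → EfqSpineStep t (plugW W (efq t))

efq-spine-step : ∀ W {t u} → plugW W (efq t) ⟶ u → EfqSpineStep t u
efq-spine-step □ (top ())
efq-spine-step □ (efqc p) = body {W = □} p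
efq-spine-step (appW W s) (top p) = ⊥-elim (efq-not-intro (efq-spine W) (app-top p))
efq-spine-step (appW W s) (appˡ p) with efq-spine-step W p
... | body {W'} q  = body {W = appW W' s} q
... | context {W'} = context {W = appW W' s}
efq-spine-step (appW W s) (appʳ {s' = s'} p) = context {W = appW W s'}
efq-spine-step (projW i W) (top p) = ⊥-elim (efq-not-intro (efq-spine W) (proj-top p))
efq-spine-step (projW i W) (projc p) with efq-spine-step W p
... | body {W'} q  = body {W = projW i W'} q
... | context {W'} = context {W = projW i W'}
efq-spine-step (caseW W s₁ s₂) (top p) = ⊥-elim (efq-not-intro (efq-spine W) (case-top p))
efq-spine-step (caseW W s₁ s₂) (case₀ p) with efq-spine-step W p
... | body {W'} q  = body {W = caseW W' s₁ s₂} q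
... | context {W'} = context {W = caseW W' s₁ s₂}
efq-spine-step (caseW W s₁ s₂) (case₁ {s₁' = s'} p) = context {W = caseW W s' s₂}
efq-spine-step (caseW W s₁ s₂) (case₂ {s₂' = s'} p) = context {W = caseW W s₁ s'}

var-spine-inert : ∀ {a a'} → VarSpine a → ¬ (a ↦ a')
var-spine-inert var      ()
var-spine-inert (app v)  r = var-not-intro v (app-top r)
var-spine-inert (proj v) r = var-not-intro v (proj-top r)
var-spine-inert (case v) r = var-not-intro v (case-top r)
var-spine-inert (hop v)  r = hop-top-rigid (var-rigid v) r

efq-spine-inert : ∀ {a a'} → EfqSpine a → ¬ (a ↦ a')
efq-spine-inert efq      ()
efq-spine-inert (app e)  r = efq-not-intro e (app-top r)
efq-spine-inert (proj e) r = efq-not-intro e (proj-top r)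
efq-spine-inert (case e) r = efq-not-intro e (case-top r)

var-spine-⟶ : ∀ {a a'} → VarSpine a → a ⟶ a' → VarSpine a'
var-spine-⟶ v        (top r)   = ⊥-elim (var-spine-inert v r)
var-spine-⟶ (app v)  (appˡ p)  = app (var-spine-⟶ v p)
var-spine-⟶ (app v)  (appʳ p)  = app v
var-spine-⟶ (proj v) (projc p) = proj (var-spine-⟶ v p)
var-spine-⟶ (case v) (case₀ p) = case (var-spine-⟶ v p)
var-spine-⟶ (case v) (case₁ p) = case v
var-spine-⟶ (case v) (case₂ p) = case v
var-spine-⟶ (hop v)  (hop₀ p)  = hop (var-spine-⟶ v p)
var-spine-⟶ (hop v)  (hop₁ p)  = hop v
var-spine-⟶ (hop v)  (hop₂ p)  = hop v

efq-spine-⟶ : ∀ {a a'} → EfqSpine a → a ⟶ a' → EfqSpine a'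
efq-spine-⟶ e        (top r)   = ⊥-elim (efq-spine-inert e r)
efq-spine-⟶ efq      (efqc p)  = efq
efq-spine-⟶ (app e)  (appˡ p)  = app (efq-spine-⟶ e p)
efq-spine-⟶ (app e)  (appʳ p)  = app e
efq-spine-⟶ (proj e) (projc p) = proj (efq-spine-⟶ e p)
efq-spine-⟶ (case e) (case₀ p) = case (efq-spine-⟶ e p)
efq-spine-⟶ (case e) (case₁ p) = case e
efq-spine-⟶ (case e) (case₂ p) = case e

-- Eliminating an SN term drawn from a reduction-closed class P of
-- non-introductions with SN arguments gives an SN term: no step can
-- contract the elimination itself.
module StuckEliminations
  (P : Tm → Set)
  (P-⟶ : ∀ {a a'} → P a → a ⟶ a' → P a')
  (P-not-intro : ∀ {a} → P a → ¬ Intro a)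
  where

  SN-app : ∀ {a s} → SN a → SN s → P a → SN (app a s)
  SN-app (sn ha) (sn hs) pa = sn λ
    { (top r)  → ⊥-elim (P-not-intro pa (app-top r))
    ; (appˡ p) → SN-app (ha p) (sn hs) (P-⟶ pa p)
    ; (appʳ p) → SN-app (sn ha) (hs p) pa }

  SN-proj : ∀ {i a} → SN a → P a → SN (proj i a)
  SN-proj (sn ha) pa = sn λ
    { (top r)   → ⊥-elim (P-not-intro pa (proj-top r))
    ; (projc p) → SN-proj (ha p) (P-⟶ pa p) }

  SN-case : ∀ {a s₁ s₂} → SN a → SN s₁ → SN s₂ → P a → SN (case a s₁ s₂)
  SN-case (sn ha) (sn h₁) (sn h₂) pa = sn λ
    { (top r)   → ⊥-elim (P-not-intro pa (case-top r))
    ; (case₀ p) → SN-case (ha p) (sn h₁) (sn h₂) (P-⟶ pa p)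
    ; (case₁ p) → SN-case (sn ha) (h₁ p) (sn h₂) pa
    ; (case₂ p) → SN-case (sn ha) (sn h₁) (h₂ p) pa }

  SN-hop : (∀ {a} → P a → ¬ EfqSpine a) →
           ∀ {a s₁ s₂} → SN a → SN s₁ → SN s₂ → P a → SN (hop a s₁ s₂)
  SN-hop P-not-efq (sn ha) (sn h₁) (sn h₂) pa = sn λ
    { (top r)  → ⊥-elim (hop-top-rigid (P-not-intro pa , P-not-efq pa) r)
    ; (hop₀ p) → SN-hop P-not-efq (ha p) (sn h₁) (sn h₂) (P-⟶ pa p)
    ; (hop₁ p) → SN-hop P-not-efq (sn ha) (h₁ p) (sn h₂) pa
    ; (hop₂ p) → SN-hop P-not-efq (sn ha) (sn h₁) (h₂ p) pa }

module VarSpineElim = StuckEliminations VarSpine var-spine-⟶ var-not-intro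
module EfqSpineElim = StuckEliminations EfqSpine efq-spine-⟶ efq-not-intro

SN-var-spine : ∀ K {x} → SNK K → SN (plugK K (var x))
SN-var-spine □               _             = SN-var
SN-var-spine (appK K s)      (k , h)       =
  VarSpineElim.SN-app (SN-var-spine K k) h (var-spine K)
SN-var-spine (projK i K)     k             =
  VarSpineElim.SN-proj (SN-var-spine K k) (var-spine K)
SN-var-spine (caseK K s₁ s₂) (k , h₁ , h₂) =
  VarSpineElim.SN-case (SN-var-spine K k) h₁ h₂ (var-spine K)
SN-var-spine (hopK K s₁ s₂)  (k , h₁ , h₂) =
  VarSpineElim.SN-hop var-not-efq (SN-var-spine K k) h₁ h₂ (var-spine K)

SN-efq-spine : ∀ W {u} → SNW W → SN u → SN (plugW W (efq u))
SN-efq-spine □               _             hu = SN-efq hu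
SN-efq-spine (appW W s)      (w , h)       hu =
  EfqSpineElim.SN-app (SN-efq-spine W w hu) h (efq-spine W)
SN-efq-spine (projW i W)     w             hu =
  EfqSpineElim.SN-proj (SN-efq-spine W w hu) (efq-spine W)
SN-efq-spine (caseW W s₁ s₂) (w , h₁ , h₂) hu =
  EfqSpineElim.SN-case (SN-efq-spine W w hu) h₁ h₂ (efq-spine W)

SN-Ne : ∀ {t} → Ne t → SN t
SN-Ne (inj₁ (K , x , k , refl))     = SN-var-spine K k
SN-Ne (inj₂ (W , u , w , h , refl)) = SN-efq-spine W w h

-- The proof is by induction on the SN-ness of the pieces and of the
-- contracted term: by  context-step  every step either contracts the
-- redex itself, reduces one of its pieces (the contractum then makes
-- zero or more corresponding steps), or reduces a term of K.

rigid-β : ∀ {t s} → Rigid (app (lam t) s)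
rigid-β = (λ ()) , λ { (app ()) }

rigid-π : ∀ {i a b} → Rigid (proj i (pair a b))
rigid-π = (λ ()) , λ { (proj ()) }

rigid-case : ∀ {i a s₁ s₂} → Rigid (case (inj i a) s₁ s₂)
rigid-case = (λ ()) , λ { (case ()) }

rigid-hop : ∀ {a s₁ s₂} → Rigid (hop a s₁ s₂)
rigid-hop = (λ ()) , (λ ())

SN-expand-β : ∀ K {t s} → SN t → SN s →
              SN (plugK K (t [ s ])) → SN (plugK K (app (lam t) s))
SN-expand-β K {t} {s} (sn ht) (sn hs) hK@(sn hk) = sn λ p → go (context-step K rigid-β p)
  where
  go : ∀ {u} → ContextStep K (app (lam t) s) u → SN u
  go (inside (top β))         = hK
  go (inside (appˡ (top ())))
  go (inside (appˡ (lamc p))) =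
    SN-expand-β K (ht p) (sn hs) (SN-⟶ hK (plug-⟶ K (sub-⟶ (single s) p)))
  go (inside (appʳ p))        =
    SN-expand-β K (sn ht) (hs p) (SN-⟶* hK (plug-⟶* K ([]-argument t p)))
  go (outside {K'} f)         = SN-expand-β K' (sn ht) (sn hs) (hk (f _))

SN-expand-π : ∀ K {i t₁ t₂} → SN t₁ → SN t₂ →
              SN (plugK K (pick i t₁ t₂)) → SN (plugK K (proj i (pair t₁ t₂)))
SN-expand-π K {i} {t₁} {t₂} (sn h₁) (sn h₂) hK@(sn hk) = sn λ p → go (context-step K rigid-π p)
  where
  go : ∀ {u} → ContextStep K (proj i (pair t₁ t₂)) u → SN u
  go (inside (top πβ))          = hK
  go (inside (projc (top ())))
  go (inside (projc (pairˡ p))) =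
    SN-expand-π K (h₁ p) (sn h₂) (SN-⟶* hK (plug-⟶* K (pick-left i p)))
  go (inside (projc (pairʳ p))) =
    SN-expand-π K (sn h₁) (h₂ p) (SN-⟶* hK (plug-⟶* K (pick-right i p)))
  go (outside {K'} f)           = SN-expand-π K' (sn h₁) (sn h₂) (hk (f _))

SN-expand-case : ∀ K {i t s₁ s₂} → SN t → SN s₁ → SN s₂ →
                 SN (plugK K (pick i s₁ s₂ [ t ])) → SN (plugK K (case (inj i t) s₁ s₂))
SN-expand-case K {i} {t} {s₁} {s₂} (sn ht) (sn h₁) (sn h₂) hK@(sn hk) =
  sn λ p → go (context-step K rigid-case p)
  where
  go : ∀ {u} → ContextStep K (case (inj i t) s₁ s₂) u → SN u
  go (inside (top caseβ))        = hK
  go (inside (case₀ (top ())))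
  go (inside (case₀ (injc p)))   =
    SN-expand-case K (ht p) (sn h₁) (sn h₂)
      (SN-⟶* hK (plug-⟶* K ([]-argument (pick i s₁ s₂) p)))
  go (inside (case₁ p))          =
    SN-expand-case K (sn ht) (h₁ p) (sn h₂) (SN-⟶* hK (plug-⟶* K ([]-body t (pick-left i p))))
  go (inside (case₂ p))          =
    SN-expand-case K (sn ht) (sn h₁) (h₂ p) (SN-⟶* hK (plug-⟶* K ([]-body t (pick-right i p))))
  go (outside {K'} f)            = SN-expand-case K' (sn ht) (sn h₁) (sn h₂) (hk (f _))

SN-expand-hop : ∀ K {i t s₁ s₂} → SN t → SN s₁ → SN s₂ →
                SN (plugK K (pick i s₁ s₂ [ lam t ])) → SN (plugK K (hop (inj i t) s₁ s₂))
SN-expand-hop K {i} {t} {s₁} {s₂} (sn ht) (sn h₁) (sn h₂) hK@(sn hk) =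
  sn λ p → go (context-step K rigid-hop p)
  where
  go : ∀ {u} → ContextStep K (hop (inj i t) s₁ s₂) u → SN u
  go (inside (top r))              = subst (SN ∘ plugK K) (sym (hop-inj-contractum r)) hK
  go (inside (hop₀ (top ())))
  go (inside (hop₀ (injc p)))      =
    SN-expand-hop K (ht p) (sn h₁) (sn h₂)
      (SN-⟶* hK (plug-⟶* K ([]-argument (pick i s₁ s₂) (lamc p))))
  go (inside (hop₁ p))             =
    SN-expand-hop K (sn ht) (h₁ p) (sn h₂)
      (SN-⟶* hK (plug-⟶* K ([]-body (lam t) (pick-left i p))))
  go (inside (hop₂ p))             =
    SN-expand-hop K (sn ht) (sn h₁) (h₂ p)
      (SN-⟶* hK (plug-⟶* K ([]-body (lam t) (pick-right i p))))
  go (outside {K'} f)              = SN-expand-hop K' (sn ht) (sn h₁) (sn h₂) (hk (f _))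

-- Here the measure is the SN-ness of the whole efq-spine  W⟨efq t⟩.
SN-expand-hopE : ∀ K W {t s₁ s₂} → SN (plugW W (efq t)) → SN s₁ → SN s₂ →
                 SN (plugK K (s₁ [ lam (efq t) ])) → SN (plugK K (hop (plugW W (efq t)) s₁ s₂))
SN-expand-hopE K W {t} {s₁} {s₂} (sn hw) (sn h₁) (sn h₂) hK@(sn hk) =
  sn λ p → go (context-step K rigid-hop p)
  where
  spine-step : ∀ {a} → plugW W (efq t) ⟶ a → EfqSpineStep t a → SN (plugK K (hop a s₁ s₂))
  spine-step p (body {W'} q)  =
    SN-expand-hopE K W' (hw p) (sn h₁) (sn h₂)
      (SN-⟶* hK (plug-⟶* K ([]-argument s₁ (lamc (efqc q)))))
  spine-step p (context {W'}) = SN-expand-hopE K W' (hw p) (sn h₁) (sn h₂) hK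

  go : ∀ {u} → ContextStep K (hop (plugW W (efq t)) s₁ s₂) u → SN u
  go (inside (top r))              = subst (SN ∘ plugK K) (sym (hop-efq-contractum W r)) hK
  go (inside (hop₀ p))             = spine-step p (efq-spine-step W p)
  go (inside (hop₁ p))             =
    SN-expand-hopE K W (sn hw) (h₁ p) (sn h₂) (SN-⟶ hK (plug-⟶ K (sub-⟶ _ p)))
  go (inside (hop₂ p))             = SN-expand-hopE K W (sn hw) (sn h₁) (h₂ p) hK
  go (outside {K'} f)              = SN-expand-hopE K' W (sn hw) (sn h₁) (sn h₂) (hk (f _))

SN-expand : ∀ {s t} → s ⟶SN t → SN t → SN s
SN-expand (step {K} _ (β ht hs))             = SN-expand-β K ht hs
SN-expand (step {K} _ (πβ h₁ h₂))            = SN-expand-π K h₁ h₂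
SN-expand (step {K} _ (caseβ ht h₁ h₂))      = SN-expand-case K ht h₁ h₂
SN-expand (step {K} _ (hopβ ht h₁ h₂))       = SN-expand-hop K ht h₁ h₂
SN-expand (step {K} _ (hopE {W} w ht h₁ h₂)) = SN-expand-hopE K W (SN-efq-spine W w ht) h₁ h₂

SN-expand* : ∀ {s t} → s ⟶SN* t → SN t → SN s
SN-expand* ε        h = h
SN-expand* (p ◅ ps) h = SN-expand p (SN-expand* ps h)

-- Neutral terms are →SN-normal: the redex contracted by a →SN step sits
-- in the hole of a K context, and spines have no such redex.

redex-↦ : ∀ {r r'} → SNRedex r r' → r ↦ r'
redex-↦ (β _ _)        = β
redex-↦ (πβ _ _)       = πβ
redex-↦ (caseβ _ _ _)  = caseβ
redex-↦ (hopβ _ _ _)   = hopβ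
redex-↦ (hopE _ _ _ _) = hopE

var-spine-unplug : ∀ K {r} → VarSpine (plugK K r) → VarSpine r
var-spine-unplug □               v        = v
var-spine-unplug (appK K s)      (app v)  = var-spine-unplug K v
var-spine-unplug (projK i K)     (proj v) = var-spine-unplug K v
var-spine-unplug (caseK K s₁ s₂) (case v) = var-spine-unplug K v
var-spine-unplug (hopK K s₁ s₂)  (hop v)  = var-spine-unplug K v

efq-spine-unplug : ∀ K {r} → EfqSpine (plugK K r) → EfqSpine r
efq-spine-unplug □               e        = e
efq-spine-unplug (appK K s)      (app e)  = efq-spine-unplug K e
efq-spine-unplug (projK i K)     (proj e) = efq-spine-unplug K e
efq-spine-unplug (caseK K s₁ s₂) (case e) = efq-spine-unplug K e
efq-spine-unplug (hopK K s₁ s₂)  ()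

Ne-normal : ∀ {t} → Ne t → NF-SN t
Ne-normal (inj₁ (K , x , _ , e)) (step {K'} _ r) =
  var-spine-inert (var-spine-unplug K' (subst VarSpine (sym e) (var-spine K))) (redex-↦ r)
Ne-normal (inj₂ (W , u , _ , _ , e)) (step {K'} _ r) =
  efq-spine-inert (efq-spine-unplug K' (subst EfqSpine (sym e) (efq-spine W))) (redex-↦ r)

closure-SN : ∀ {T : Tm → Set} → (∀ {u} → T u → SN u) → ∀ {t} → closure T t → SN t
closure-SN T⊆SN (_ , (steps , _) , u∈T) = SN-expand* steps (T⊆SN u∈T)

closure-Ne : ∀ {t} → Ne t → closure Ne t
closure-Ne n = _ , (ε , Ne-normal n) , n

closure-backward : ∀ {T : Tm → Set} {s t} → s ⟶SN t → closure T t → closure T s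
closure-backward p (u , (steps , nf) , u∈T) = u , (p ◅ steps , nf) , u∈T

Ne⊆⟦⟧ : ∀ A {t} → Ne t → ⟦ A ⟧ t
Ne⊆⟦⟧ (atom p) n = SN-Ne n
Ne⊆⟦⟧ falsum   n = SN-Ne n
Ne⊆⟦⟧ (A ⇒ B)  n = inj₂ (closure-Ne n)
Ne⊆⟦⟧ (A ∧ B)  n = inj₂ (closure-Ne n)
Ne⊆⟦⟧ (A ∨ B)  n = inj₂ (closure-Ne n)

-- For  λb  with  b[s] ∈ ⟦B⟧  for all  s ∈ ⟦A⟧, take s the neutral variable 0:
-- b[0] is SN, hence so are b and λb.
⟦⟧⊆SN : ∀ A {t} → ⟦ A ⟧ t → SN t
⟦⟧⊆SN (atom p) h = h
⟦⟧⊆SN falsum   h = h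
⟦⟧⊆SN (A ⇒ B)  h = [ closure-SN SN-abstraction , closure-SN SN-Ne ] h
  where
  SN-abstraction : ∀ {u} → Σ Tm (λ b → u ≡ lam b × (∀ s → ⟦ A ⟧ s → ⟦ B ⟧ (b [ s ]))) → SN u
  SN-abstraction (b , refl , b[]∈B) =
    SN-lam (SN-unsub (single (var 0)) b (⟦⟧⊆SN B (b[]∈B (var 0) (Ne⊆⟦⟧ A var-Ne))))
    where var-Ne : Ne (var 0)
          var-Ne = inj₁ (□ , 0 , tt , refl)
⟦⟧⊆SN (A ∧ B)  h = [ closure-SN SN-pairing , closure-SN SN-Ne ] h
  where
  SN-pairing : ∀ {u} → Σ Tm (λ t₁ → Σ Tm λ t₂ → u ≡ pair t₁ t₂ × ⟦ A ⟧ t₁ × ⟦ B ⟧ t₂) → SN u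
  SN-pairing (_ , _ , refl , h₁ , h₂) = SN-pair (⟦⟧⊆SN A h₁) (⟦⟧⊆SN B h₂)
⟦⟧⊆SN (A ∨ B)  h = [ closure-SN SN-injection , closure-SN SN-Ne ] h
  where
  SN-injection : ∀ {u} → (Σ Tm λ a → u ≡ inj i₁ a × ⟦ A ⟧ a)
                       ⊎ (Σ Tm λ a → u ≡ inj i₂ a × ⟦ B ⟧ a) → SN u
  SN-injection (inj₁ (_ , refl , ha)) = SN-inj (⟦⟧⊆SN A ha)
  SN-injection (inj₂ (_ , refl , hb)) = SN-inj (⟦⟧⊆SN B hb)

⟦⟧-backward : ∀ A {s t} → s ⟶SN t → ⟦ A ⟧ t → ⟦ A ⟧ s
⟦⟧-backward (atom p) r h = SN-expand r h
⟦⟧-backward falsum   r h = SN-expand r h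
⟦⟧-backward (A ⇒ B)  r h = Sum.map (closure-backward r) (closure-backward r) h
⟦⟧-backward (A ∧ B)  r h = Sum.map (closure-backward r) (closure-backward r) h
⟦⟧-backward (A ∨ B)  r h = Sum.map (closure-backward r) (closure-backward r) h

mainTheorem12 : (A : Form) →
    ((t : Tm) → ⟦ A ⟧ t → SN t)
    × ((t : Tm) → Ne t → ⟦ A ⟧ t)
    × ((t s : Tm) → ⟦ A ⟧ t → s ⟶SN t → ⟦ A ⟧ s)
mainTheorem12 A =
  (λ t → ⟦⟧⊆SN A) , (λ t → Ne⊆⟦⟧ A) , (λ t s h r → ⟦⟧-backward A r h)
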